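{- Let $n \geq 1$ and let $\mathcal{A} \subset 2^{[n]}$ be a collection of odd-sized subsets of $[n]$ with $|\mathcal{A}| \geq n+1$. Then $\mathrm{op}(\mathcal{A}) \geq 3$.
   Context: $[n]=\{1,\ldots,n\}$ and $2^{[n]}$ denotes the collection of all subsets of $[n]$. For a collection $\mathcal{A}$ of sets, $\mathrm{op}(\mathcal{A})$ denotes the number of unordered pairs of distinct sets $A,B\in\mathcal{A}$ for which $|A\cap B|$ is odd. -}

module Defs where

open import Data.Nat using (ℕ; zero; suc; _+_)
open import Data.Nat.Properties using ()
open import Data.Bool using (Bool; true; false; if_then_else_)
open import Data.List using (List; []; _∷_)
open import Data.Fin.Subset using (Subset; _∩_; ∣_∣)

isOdd : ℕ → Bool
isOdd zero = false
isOdd (suc n) = if isOdd n then false else true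

OddSized : ∀ {n} → Subset n → Bool
OddSized A = isOdd ∣ A ∣

oddWith : ∀ {n} → Subset n → List (Subset n) → ℕ
oddWith A [] = 0
oddWith A (B ∷ Bs) = (if isOdd ∣ A ∩ B ∣ then 1 else 0) + oddWith A Bs

-- op(𝒜): number of unordered pairs of distinct positions {i,j} (i<j) in the
-- list whose members have odd-sized intersection.  For a duplicate-free list
-- this is the number of unordered pairs of distinct sets with odd intersection.
op : ∀ {n} → List (Subset n) → ℕ
op [] = 0
op (A ∷ As) = oddWith A As + op As

-- Identify subsets of [n] with vectors of 𝔽₂ⁿ: |A ∩ B| mod 2 is the dot product and the
-- odd-sized sets are the non-isotropic vectors.  If op(𝒜) ≤ 2, the odd pairs form at most
-- one edge, a path y – x – z, or two disjoint edges, and 𝒜 can be traded for |𝒜| linearly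
-- independent vectors: for a path, replacing x by y + x + z gives an orthonormal family; for
-- an edge {x, y}, drop one end of the other edge (if any) and add the nonzero isotropic
-- vector x + y together with some u with (x + y) · u = 1.  Independence is certified by a
-- triangular system of test vectors, and Gaussian elimination shows that such a system has
-- at most n < |𝒜| members.
module Submission where

open import Defs
open import Algebra.Bundles using (CommutativeSemigroup; CommutativeRing)
import Algebra.Properties.CommutativeSemigroup as CommSemigroupProps
open import Data.Bool using (Bool; true; false; _∧_; _xor_; not; if_then_else_; T)
open import Data.Bool.Properties
  using (∧-comm; ∧-distribˡ-xor; xor-assoc; xor-comm; xor-same; xor-identityʳ;
         xor-∧-commutativeRing; T-≡)
open import Data.Fin.Subset using (Subset; _∩_; ∣_∣) renaming (⊥ to ∅)
open import Data.Fin.Subset.Properties using (∩-comm; ∩-idem)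
open import Data.List using (List; []; _∷_; _++_; foldr; map; length)
open import Data.List.Properties using (length-map; length-++)
open import Data.List.Relation.Binary.Permutation.Propositional as ↭
  using (_↭_; prep; swap; ↭-refl; ↭-trans; ↭-sym; ↭⇒↭ₛ)
open import Data.List.Relation.Binary.Permutation.Propositional.Properties
  using (All-resp-↭; ↭-length; shift)
import Data.List.Relation.Binary.Permutation.Setoid.Properties as PermutationSetoid
open import Data.List.Relation.Binary.Sublist.Propositional using (_⊆_; []; _∷_; _∷ʳ_; minimum)
open import Data.List.Relation.Binary.Sublist.Propositional.Properties using (All-resp-⊆)
open import Data.List.Relation.Unary.All as All using (All; []; _∷_)
open import Data.List.Relation.Unary.All.Properties using (++⁺)
open import Data.List.Relation.Unary.AllPairs using (AllPairs; []; _∷_)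
open import Data.List.Relation.Unary.Unique.Propositional using (Unique)
open import Data.Nat using (ℕ; zero; suc; _+_; _≤_; z≤n; s≤s; _≤?_)
open import Data.Nat.Properties
  using (≤-refl; ≤-trans; ≤-reflexive; ≤-pred; n≤0⇒n≡0; suc-injective; <⇒≱; ≰⇒>;
         +-suc; +-comm; +-monoˡ-≤; m≤n+m; m+n≡0⇒m≡0; m+n≡0⇒n≡0; +-commutativeSemigroup)
open import Data.Product using (∃; ∃₂; _×_; _,_)
open import Data.Sum using (_⊎_; inj₁; inj₂)
open import Data.Vec using (_∷_; []; zipWith)
open import Data.Vec.Properties using (zipWith-assoc; zipWith-comm; zipWith-identityˡ; zipWith-identityʳ)
open import Function using (_∘_; id)
open import Function.Bundles using (Equivalence)
open import Relation.Binary.PropositionalEquality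
  using (_≡_; _≢_; refl; sym; trans; cong; cong₂; subst; setoid; module ≡-Reasoning)
open import Relation.Binary.PropositionalEquality.Algebra using (isMagma)
open import Relation.Nullary using (contradiction)
open import Relation.Nullary.Decidable using (yes; no)

open ≡-Reasoning

private
  variable
    n : ℕ

infixl 6 _⊕_
infix 7 _·_
infix 4 _⊥_

_⊕_ : Subset n → Subset n → Subset n
_⊕_ = zipWith _xor_

_·_ : Subset n → Subset n → Bool
[] · [] = false
(a ∷ x) · (b ∷ y) = (a ∧ b) xor (x · y)

_⊥_ : Subset n → Subset n → Set
x ⊥ y = x · y ≡ false

Unit : Subset n → Set
Unit x = x · x ≡ true

⊕-assoc : (x y z : Subset n) → x ⊕ y ⊕ z ≡ x ⊕ (y ⊕ z)
⊕-assoc = zipWith-assoc xor-assoc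

⊕-comm : (x y : Subset n) → x ⊕ y ≡ y ⊕ x
⊕-comm = zipWith-comm xor-comm

⊕-commutativeSemigroup : ℕ → CommutativeSemigroup _ _
⊕-commutativeSemigroup n = record
  { _∙_ = _⊕_ {n}
  ; isCommutativeSemigroup = record
    { isSemigroup = record { isMagma = isMagma _⊕_ ; assoc = ⊕-assoc }
    ; comm = ⊕-comm
    }
  }

module ⊕-Props {n} = CommSemigroupProps (⊕-commutativeSemigroup n)
module ℕ-Props = CommSemigroupProps +-commutativeSemigroup
open CommSemigroupProps (CommutativeRing.+-commutativeSemigroup xor-∧-commutativeRing)
  using () renaming (interchange to xor-interchange)

⊕-identityˡ : (x : Subset n) → ∅ ⊕ x ≡ x
⊕-identityˡ = zipWith-identityˡ (λ _ → refl)

⊕-identityʳ : (x : Subset n) → x ⊕ ∅ ≡ x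
⊕-identityʳ = zipWith-identityʳ xor-identityʳ

⊕-self : (x : Subset n) → x ⊕ x ≡ ∅
⊕-self [] = refl
⊕-self (a ∷ x) = cong₂ _∷_ (xor-same a) (⊕-self x)

⊕≡∅⇒≡ : (x y : Subset n) → x ⊕ y ≡ ∅ → x ≡ y
⊕≡∅⇒≡ x y x⊕y≡∅ = begin
  x              ≡⟨ sym (⊕-identityʳ x) ⟩
  x ⊕ ∅          ≡⟨ cong (x ⊕_) (sym (⊕-self y)) ⟩
  x ⊕ (y ⊕ y)    ≡⟨ sym (⊕-assoc x y y) ⟩
  x ⊕ y ⊕ y      ≡⟨ cong (_⊕ y) x⊕y≡∅ ⟩
  ∅ ⊕ y          ≡⟨ ⊕-identityˡ y ⟩
  y              ∎

·-comm : (x y : Subset n) → x · y ≡ y · x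
·-comm [] [] = refl
·-comm (a ∷ x) (b ∷ y) = cong₂ _xor_ (∧-comm a b) (·-comm x y)

·-⊕ʳ : (t x y : Subset n) → t · (x ⊕ y) ≡ t · x xor t · y
·-⊕ʳ [] [] [] = refl
·-⊕ʳ (a ∷ t) (b ∷ x) (c ∷ y) = begin
  (a ∧ (b xor c)) xor t · (x ⊕ y)              ≡⟨ cong₂ _xor_ (∧-distribˡ-xor a b c) (·-⊕ʳ t x y) ⟩
  ((a ∧ b) xor (a ∧ c)) xor (t · x xor t · y)  ≡⟨ xor-interchange (a ∧ b) (a ∧ c) (t · x) (t · y) ⟩
  ((a ∧ b) xor t · x) xor ((a ∧ c) xor t · y)  ∎

·-⊕ˡ : (x y t : Subset n) → (x ⊕ y) · t ≡ x · t xor y · t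
·-⊕ˡ x y t = begin
  (x ⊕ y) · t          ≡⟨ ·-comm (x ⊕ y) t ⟩
  t · (x ⊕ y)          ≡⟨ ·-⊕ʳ t x y ⟩
  t · x xor t · y      ≡⟨ cong₂ _xor_ (·-comm t x) (·-comm t y) ⟩
  x · t xor y · t      ∎

·-∅ʳ : (t : Subset n) → t ⊥ ∅
·-∅ʳ [] = refl
·-∅ʳ (true ∷ t) = ·-∅ʳ t
·-∅ʳ (false ∷ t) = ·-∅ʳ t

·-nondegenerate : (e : Subset n) → e ≢ ∅ → ∃ λ u → e · u ≡ true
·-nondegenerate [] e≢∅ = contradiction refl e≢∅
·-nondegenerate (true ∷ e) _ = true ∷ ∅ , cong not (·-∅ʳ e)
·-nondegenerate (false ∷ e) e≢∅ with ·-nondegenerate e (e≢∅ ∘ cong (false ∷_))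
... | u , e·u = false ∷ u , e·u

⨁ : List (Subset n) → Subset n
⨁ = foldr _⊕_ ∅

Independent : List (Subset n) → Set
Independent xs = ∀ {ys} → ys ⊆ xs → ⨁ ys ≡ ∅ → ys ≡ []

⊥-⨁ : (t : Subset n) {ys : List (Subset n)} → All (t ⊥_) ys → t ⊥ ⨁ ys
⊥-⨁ t [] = ·-∅ʳ t
⊥-⨁ t {y ∷ ys} (t⊥y ∷ t⊥ys) = begin
  t · (y ⊕ ⨁ ys)        ≡⟨ ·-⊕ʳ t y (⨁ ys) ⟩
  t · y xor t · ⨁ ys    ≡⟨ cong₂ _xor_ t⊥y (⊥-⨁ t t⊥ys) ⟩
  false                 ∎

data Triangular {n} : List (Subset n) → Set where
  []   : Triangular []
  cons : ∀ {x xs} (t : Subset n) → t · x ≡ true → All (t ⊥_) xs → Triangular xs →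
         Triangular (x ∷ xs)

triangular⇒independent : {xs : List (Subset n)} → Triangular xs → Independent xs
triangular⇒independent [] [] _ = refl
triangular⇒independent (cons _ _ _ tri) (_ ∷ʳ σ) ⨁≡∅ = triangular⇒independent tri σ ⨁≡∅
triangular⇒independent {xs = x ∷ _} (cons t t·x t⊥xs _) (_∷_ {xs = ys} refl σ) ⨁≡∅ =
  contradiction (trans (sym t·⨁) (trans (cong (t ·_) ⨁≡∅) (·-∅ʳ t))) λ ()
  where
  t·⨁ : t · (x ⊕ ⨁ ys) ≡ true
  t·⨁ = begin
    t · (x ⊕ ⨁ ys)       ≡⟨ ·-⊕ʳ t x (⨁ ys) ⟩
    t · x xor t · ⨁ ys   ≡⟨ cong₂ _xor_ t·x (⊥-⨁ t (All-resp-⊆ σ t⊥xs)) ⟩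
    true                 ∎

lower : Subset n → Subset (suc n) → Subset n
lower p (false ∷ x) = x
lower p (true ∷ x) = p ⊕ x

lower-⊕ : (p : Subset n) (x y : Subset (suc n)) → lower p (x ⊕ y) ≡ lower p x ⊕ lower p y
lower-⊕ p (false ∷ x) (false ∷ y) = refl
lower-⊕ p (false ∷ x) (true ∷ y) = ⊕-Props.x∙yz≈y∙xz p x y
lower-⊕ p (true ∷ x) (false ∷ y) = sym (⊕-assoc p x y)
lower-⊕ p (true ∷ x) (true ∷ y) = begin
  x ⊕ y              ≡⟨ sym (⊕-identityˡ (x ⊕ y)) ⟩
  ∅ ⊕ (x ⊕ y)        ≡⟨ cong (_⊕ (x ⊕ y)) (sym (⊕-self p)) ⟩
  p ⊕ p ⊕ (x ⊕ y)    ≡⟨ ⊕-Props.interchange p p x y ⟩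
  p ⊕ x ⊕ (p ⊕ y)    ∎

lower-⨁ : (p : Subset n) (zs : List (Subset (suc n))) → ⨁ (map (lower p) zs) ≡ lower p (⨁ zs)
lower-⨁ p [] = refl
lower-⨁ p (z ∷ zs) = begin
  lower p z ⊕ ⨁ (map (lower p) zs)   ≡⟨ cong (lower p z ⊕_) (lower-⨁ p zs) ⟩
  lower p z ⊕ lower p (⨁ zs)         ≡⟨ sym (lower-⊕ p z (⨁ zs)) ⟩
  lower p (z ⊕ ⨁ zs)                 ∎

eliminate : List (Subset (suc n)) → List (Subset n)
eliminate [] = []
eliminate ((false ∷ x) ∷ xs) = x ∷ eliminate xs
eliminate ((true ∷ p) ∷ xs) = map (lower p) xs

length-eliminate : (xs : List (Subset (suc n))) → length xs ≤ suc (length (eliminate xs))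
length-eliminate [] = z≤n
length-eliminate ((false ∷ x) ∷ xs) = s≤s (length-eliminate xs)
length-eliminate ((true ∷ p) ∷ xs) = s≤s (≤-reflexive (sym (length-map (lower p) xs)))

⊆-map⁻ : {A B : Set} (f : A → B) (xs : List A) {ys : List B} →
         ys ⊆ map f xs → ∃ λ zs → zs ⊆ xs × ys ≡ map f zs
⊆-map⁻ f [] [] = [] , [] , refl
⊆-map⁻ f (x ∷ xs) (_ ∷ʳ σ) with ⊆-map⁻ f xs σ
... | zs , τ , ys≡ = zs , x ∷ʳ τ , ys≡
⊆-map⁻ f (x ∷ xs) (refl ∷ σ) with ⊆-map⁻ f xs σ
... | zs , τ , ys≡ = x ∷ zs , refl ∷ τ , cong (f x ∷_) ys≡

lower-cleared : (p : Subset n) (z : Subset (suc n)) →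
                z ≡ false ∷ lower p z ⊎ (true ∷ p) ⊕ z ≡ false ∷ lower p z
lower-cleared p (false ∷ z) = inj₁ refl
lower-cleared p (true ∷ z) = inj₂ refl

Lift : List (Subset (suc n)) → List (Subset n) → Set
Lift xs ys = ∃ λ zs → zs ⊆ xs × ⨁ zs ≡ false ∷ ⨁ ys × (zs ≡ [] → ys ≡ [])

lift-pivot : (p : Subset n) {xs zs : List (Subset (suc n))} → zs ⊆ xs →
             ∃ λ ws → ws ⊆ (true ∷ p) ∷ xs × ⨁ ws ≡ false ∷ lower p (⨁ zs) × (ws ≡ [] → zs ≡ [])
lift-pivot p {zs = zs} τ with lower-cleared p (⨁ zs)
... | inj₁ ⨁zs≡ = zs , _ ∷ʳ τ , ⨁zs≡ , id
... | inj₂ ⨁zs≡ = (true ∷ p) ∷ zs , refl ∷ τ , ⨁zs≡ , λ ()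

lift : (xs : List (Subset (suc n))) {ys : List (Subset n)} → ys ⊆ eliminate xs → Lift xs ys
lift [] [] = [] , [] , refl , λ _ → refl
lift ((false ∷ x) ∷ xs) (_ ∷ʳ σ) with lift xs σ
... | zs , τ , ⨁zs≡ , empty = zs , _ ∷ʳ τ , ⨁zs≡ , empty
lift ((false ∷ x) ∷ xs) (refl ∷ σ) with lift xs σ
... | zs , τ , ⨁zs≡ , _ = (false ∷ x) ∷ zs , refl ∷ τ , cong ((false ∷ x) ⊕_) ⨁zs≡ , λ ()
lift ((true ∷ p) ∷ xs) σ with ⊆-map⁻ (lower p) xs σ
... | zs , τ , refl with lift-pivot p τ
...   | ws , ω , ⨁ws≡ , empty =
        ws , ω , trans ⨁ws≡ (cong (false ∷_) (sym (lower-⨁ p zs))) , cong (map (lower p)) ∘ empty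

independent-eliminate : {xs : List (Subset (suc n))} → Independent xs → Independent (eliminate xs)
independent-eliminate {xs = xs} ind σ ⨁≡∅ with lift xs σ
... | zs , τ , ⨁zs≡ , empty = empty (ind τ (trans ⨁zs≡ (cong (false ∷_) ⨁≡∅)))

independent⇒length≤ : (xs : List (Subset n)) → Independent xs → length xs ≤ n
independent⇒length≤ {zero} [] _ = z≤n
independent⇒length≤ {zero} ([] ∷ xs) ind with ind (refl ∷ minimum xs) refl
... | ()
independent⇒length≤ {suc n} xs ind =
  ≤-trans (length-eliminate xs) (s≤s (independent⇒length≤ (eliminate xs) (independent-eliminate ind)))

triangular⇒length≤ : {xs : List (Subset n)} → Triangular xs → length xs ≤ n
triangular⇒length≤ tri = independent⇒length≤ _ (triangular⇒independent tri)

Orthonormal : List (Subset n) → Set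
Orthonormal xs = AllPairs _⊥_ xs × All Unit xs

orthonormal⇒triangular : {xs : List (Subset n)} → Orthonormal xs → Triangular xs
orthonormal⇒triangular ([] , []) = []
orthonormal⇒triangular {xs = x ∷ _} (x⊥xs ∷ ⊥s , ux ∷ us) =
  cons x ux x⊥xs (orthonormal⇒triangular (⊥s , us))

⊥-sym : (x y : Subset n) → x ⊥ y → y ⊥ x
⊥-sym x y x⊥y = trans (·-comm y x) x⊥y

⊕-⊥ : (x y : Subset n) {zs : List (Subset n)} →
      All (x ⊥_) zs → All (y ⊥_) zs → All ((x ⊕ y) ⊥_) zs
⊕-⊥ x y [] [] = []
⊕-⊥ x y {z ∷ _} (x⊥z ∷ x⊥zs) (y⊥z ∷ y⊥zs) =
  trans (·-⊕ˡ x y z) (cong₂ _xor_ x⊥z y⊥z) ∷ ⊕-⊥ x y x⊥zs y⊥zs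

-- e is the test vector of u, and u that of e, which therefore has to come last.
isotropic-extension : {os : List (Subset n)} {e : Subset n} → Orthonormal os → All (e ⊥_) os →
                      e ⊥ e → e ≢ ∅ → ∃ λ u → Triangular (u ∷ os ++ e ∷ [])
isotropic-extension {os = os} {e} on e⊥os e⊥e e≢∅ with ·-nondegenerate e e≢∅
... | u , e·u = u , cons e e·u (++⁺ e⊥os (e⊥e ∷ [])) (orthonormal-then-e on e⊥os)
  where
  orthonormal-then-e : ∀ {xs} → Orthonormal xs → All (e ⊥_) xs → Triangular (xs ++ e ∷ [])
  orthonormal-then-e ([] , []) [] = cons u (trans (·-comm u e) e·u) [] []
  orthonormal-then-e {x ∷ _} (x⊥xs ∷ ⊥s , ux ∷ us) (e⊥x ∷ e⊥xs) =
    cons x ux (++⁺ x⊥xs (⊥-sym e x e⊥x ∷ [])) (orthonormal-then-e (⊥s , us) e⊥xs)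

odd-edge-triangular : (x y : Subset n) {os : List (Subset n)} →
                      x · y ≡ true → x ≢ y → Unit x → Unit y →
                      Orthonormal os → All (x ⊥_) os → All (y ⊥_) os →
                      ∃ λ ys → Triangular ys × 3 + length os ≤ length ys
odd-edge-triangular x y {os} x·y x≢y ux uy (⊥s , us) x⊥os y⊥os =
  let u , tri = isotropic-extension (x⊥os ∷ ⊥s , ux ∷ us) (e⊥x ∷ ⊕-⊥ x y x⊥os y⊥os) e⊥e
                                    (x≢y ∘ ⊕≡∅⇒≡ x y)
  in u ∷ x ∷ os ++ x ⊕ y ∷ [] , tri ,
     ≤-reflexive (cong (2 +_) (sym (trans (length-++ os) (+-comm (length os) 1))))
  where
  e⊥x : x ⊕ y ⊥ x
  e⊥x rewrite ·-⊕ˡ x y x | ux | ·-comm y x | x·y = refl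
  e⊥e : x ⊕ y ⊥ x ⊕ y
  e⊥e rewrite ·-⊕ˡ x y (x ⊕ y) | ·-⊕ʳ x x y | ·-⊕ʳ y x y | ux | uy | ·-comm y x | x·y = refl

path-orthonormal : (x y z : Subset n) {r : List (Subset n)} →
                   x · y ≡ true → x · z ≡ true → Unit x → Unit y →
                   All (y ⊥_) (z ∷ r) → All (x ⊥_) r → Orthonormal (z ∷ r) →
                   Orthonormal (y ∷ y ⊕ x ⊕ z ∷ z ∷ r)
path-orthonormal x y z x·y x·z ux uy (y⊥z ∷ y⊥r) x⊥r (z⊥r ∷ ⊥s , uz ∷ us) =
  (y⊥b ∷ y⊥z ∷ y⊥r) ∷ (b⊥z ∷ ⊕-⊥ (y ⊕ x) z (⊕-⊥ y x y⊥r x⊥r) z⊥r) ∷ z⊥r ∷ ⊥s ,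
  uy ∷ ub ∷ uz ∷ us
  where
  b = y ⊕ x ⊕ z
  y⊥b : y ⊥ b
  y⊥b rewrite ·-⊕ʳ y (y ⊕ x) z | ·-⊕ʳ y y x | uy | ·-comm y x | x·y | y⊥z = refl
  x·b : x · b ≡ true
  x·b rewrite ·-⊕ʳ x (y ⊕ x) z | ·-⊕ʳ x y x | x·y | ux | x·z = refl
  b⊥z : b ⊥ z
  b⊥z rewrite ·-⊕ˡ (y ⊕ x) z z | ·-⊕ˡ y x z | y⊥z | x·z | uz = refl
  ub : Unit b
  ub rewrite ·-⊕ˡ (y ⊕ x) z b | ·-⊕ˡ y x b | y⊥b | x·b | ⊥-sym b z b⊥z = refl

isOdd-suc : (k : ℕ) → isOdd (suc k) ≡ not (isOdd k)
isOdd-suc k with isOdd k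
... | true = refl
... | false = refl

isOdd-∣∩∣ : (A B : Subset n) → isOdd ∣ A ∩ B ∣ ≡ A · B
isOdd-∣∩∣ [] [] = refl
isOdd-∣∩∣ (true ∷ A) (true ∷ B) = trans (isOdd-suc ∣ A ∩ B ∣) (cong not (isOdd-∣∩∣ A B))
isOdd-∣∩∣ (true ∷ A) (false ∷ B) = isOdd-∣∩∣ A B
isOdd-∣∩∣ (false ∷ A) (true ∷ B) = isOdd-∣∩∣ A B
isOdd-∣∩∣ (false ∷ A) (false ∷ B) = isOdd-∣∩∣ A B

oddWith-↭ : (A : Subset n) {l l′ : List (Subset n)} → l ↭ l′ → oddWith A l ≡ oddWith A l′
oddWith-↭ A ↭.refl = refl
oddWith-↭ A (prep B p) = cong (_ +_) (oddWith-↭ A p)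
oddWith-↭ A (swap {xs = l} B C p) =
  trans (ℕ-Props.x∙yz≈y∙xz (odd B) (odd C) (oddWith A l))
        (cong (λ k → odd C + (odd B + k)) (oddWith-↭ A p))
  where
  odd : Subset _ → ℕ
  odd X = if isOdd ∣ A ∩ X ∣ then 1 else 0
oddWith-↭ A (↭.trans p q) = trans (oddWith-↭ A p) (oddWith-↭ A q)

op-↭ : {l l′ : List (Subset n)} → l ↭ l′ → op l ≡ op l′
op-↭ ↭.refl = refl
op-↭ (prep A p) = cong₂ _+_ (oddWith-↭ A p) (op-↭ p)
op-↭ (swap {ys = l} A B p) rewrite ∩-comm A B | oddWith-↭ A p | oddWith-↭ B p | op-↭ p =
  ℕ-Props.interchange (if isOdd ∣ B ∩ A ∣ then 1 else 0) (oddWith A l) (oddWith B l) (op l)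
op-↭ (↭.trans p q) = trans (op-↭ p) (op-↭ q)

oddWith-odd : (A B : Subset n) (Bs : List (Subset n)) → A · B ≡ true →
              oddWith A (B ∷ Bs) ≡ suc (oddWith A Bs)
oddWith-odd A B Bs A·B rewrite isOdd-∣∩∣ A B | A·B = refl

op-odd-pair : (x y : Subset n) (r : List (Subset n)) → x · y ≡ true →
              op (x ∷ y ∷ r) ≡ suc (oddWith x r + (oddWith y r + op r))
op-odd-pair x y r x·y = cong (_+ (oddWith y r + op r)) (oddWith-odd x y r x·y)

oddWith≡0⇒⊥ : (A : Subset n) (l : List (Subset n)) → oddWith A l ≡ 0 → All (A ⊥_) l
oddWith≡0⇒⊥ A [] _ = []
oddWith≡0⇒⊥ A (B ∷ Bs) ow≡0 with isOdd ∣ A ∩ B ∣ in odd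
... | false = trans (sym (isOdd-∣∩∣ A B)) odd ∷ oddWith≡0⇒⊥ A Bs ow≡0

op≡0⇒orthogonal : (l : List (Subset n)) → op l ≡ 0 → AllPairs _⊥_ l
op≡0⇒orthogonal [] _ = []
op≡0⇒orthogonal (A ∷ l) op≡0 =
  oddWith≡0⇒⊥ A l (m+n≡0⇒m≡0 (oddWith A l) op≡0) ∷
  op≡0⇒orthogonal l (m+n≡0⇒n≡0 (oddWith A l) op≡0)

oddWith≡suc⇒odd-partner : (A : Subset n) (l : List (Subset n)) {k : ℕ} → oddWith A l ≡ suc k →
                          ∃₂ λ z r → l ↭ z ∷ r × A · z ≡ true
oddWith≡suc⇒odd-partner A (B ∷ Bs) ow≡ with isOdd ∣ A ∩ B ∣ in odd
... | true = B , Bs , ↭-refl , trans (sym (isOdd-∣∩∣ A B)) odd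
... | false =
  let z , r , p , A·z = oddWith≡suc⇒odd-partner A Bs ow≡
  in z , B ∷ r , ↭-trans (prep B p) (↭-sym (shift B (z ∷ []) r)) , A·z

op≡suc⇒odd-pair : (l : List (Subset n)) {k : ℕ} → op l ≡ suc k →
                  ∃ λ x → ∃₂ λ y r → l ↭ x ∷ y ∷ r × x · y ≡ true
op≡suc⇒odd-pair (A ∷ l) op≡ with oddWith A l in ow
... | suc _ =
  let z , r , p , A·z = oddWith≡suc⇒odd-partner A l ow
  in A , z , r , prep A p , A·z
... | zero =
  let x , y , r , p , x·y = op≡suc⇒odd-pair l op≡
  in x , y , A ∷ r , ↭-trans (prep A p) (↭-sym (shift A (x ∷ y ∷ []) r)) , x·y

orthogonal-sublist : (l : List (Subset n)) →
                     ∃ λ l′ → l′ ⊆ l × AllPairs _⊥_ l′ × length l ≤ op l + length l′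
orthogonal-sublist [] = [] , [] , [] , z≤n
orthogonal-sublist (A ∷ Bs) with oddWith A Bs in ow | orthogonal-sublist Bs
... | zero | l′ , σ , ⊥s , len =
  A ∷ l′ , refl ∷ σ , All-resp-⊆ σ (oddWith≡0⇒⊥ A Bs ow) ∷ ⊥s ,
  ≤-trans (s≤s len) (≤-reflexive (sym (+-suc (op Bs) (length l′))))
... | suc k | l′ , σ , ⊥s , len =
  l′ , A ∷ʳ σ , ⊥s , s≤s (≤-trans len (+-monoˡ-≤ (length l′) (m≤n+m (op Bs) k)))

odd-path-triangular : (x y : Subset n) (r : List (Subset n)) →
                      x · y ≡ true → oddWith x r ≡ 1 → oddWith y r ≡ 0 → op r ≡ 0 →
                      Unit x → Unit y → All Unit r → ∃ λ ys → Triangular ys × 2 + length r ≤ length ys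
odd-path-triangular x y r x·y x₁ y₀ op≡0 ux uy ur =
  let z , r′ , r↭ , x·z = oddWith≡suc⇒odd-partner x r x₁
      x₀ = suc-injective (trans (sym (oddWith-odd x z r′ x·z)) (trans (sym (oddWith-↭ x r↭)) x₁))
      zr′-orthonormal = op≡0⇒orthogonal (z ∷ r′) (trans (sym (op-↭ r↭)) op≡0) , All-resp-↭ r↭ ur
      y⊥zr′ = All-resp-↭ r↭ (oddWith≡0⇒⊥ y r y₀)
  in y ∷ y ⊕ x ⊕ z ∷ z ∷ r′ ,
     orthonormal⇒triangular
       (path-orthonormal x y z x·y x·z ux uy y⊥zr′ (oddWith≡0⇒⊥ x r′ x₀) zr′-orthonormal) ,
     ≤-reflexive (cong (2 +_) (↭-length r↭))

odd-pair⇒triangular : (x y : Subset n) (r : List (Subset n)) →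
                      x · y ≡ true → x ≢ y → Unit x → Unit y → All Unit r →
                      oddWith x r + (oddWith y r + op r) ≤ 1 →
                      ∃ λ ys → Triangular ys × 2 + length r ≤ length ys
odd-pair⇒triangular x y r x·y x≢y ux uy ur bound with oddWith x r in x₀ | oddWith y r in y₀
... | zero | zero =
  let r′ , σ , ⊥s , len = orthogonal-sublist r
      ys , tri , len′ = odd-edge-triangular x y x·y x≢y ux uy (⊥s , All-resp-⊆ σ ur)
                          (All-resp-⊆ σ (oddWith≡0⇒⊥ x r x₀)) (All-resp-⊆ σ (oddWith≡0⇒⊥ y r y₀))
  in ys , tri , ≤-trans (s≤s (s≤s (≤-trans len (+-monoˡ-≤ (length r′) bound)))) len′
... | suc zero | zero = odd-path-triangular x y r x·y x₀ y₀ (n≤0⇒n≡0 (≤-pred bound)) ux uy ur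
... | zero | suc zero =
  odd-path-triangular y x r (trans (·-comm y x) x·y) y₀ x₀ (n≤0⇒n≡0 (≤-pred bound)) uy ux ur
odd-pair⇒triangular _ _ _ _ _ _ _ _ (s≤s ()) | suc (suc _) | _
odd-pair⇒triangular _ _ _ _ _ _ _ _ (s≤s ()) | suc zero | suc _
odd-pair⇒triangular _ _ _ _ _ _ _ _ (s≤s ()) | zero | suc (suc _)

op≤2⇒triangular : (L : List (Subset n)) → Unique L → All Unit L → op L ≤ 2 →
                  ∃ λ ys → Triangular ys × length L ≤ length ys
op≤2⇒triangular {n} L unique units op≤2 with op L in op≡
... | zero = L , orthonormal⇒triangular (op≡0⇒orthogonal L op≡ , units) , ≤-refl
... | suc k with op≡suc⇒odd-pair L op≡
...   | x , y , r , L↭ , x·y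
        with PermutationSetoid.Unique-resp-↭ (setoid (Subset n)) (↭⇒↭ₛ L↭) unique | All-resp-↭ L↭ units
...     | (x≢y ∷ _) ∷ _ | ux ∷ uy ∷ ur =
  let op≡′ = trans (sym (op-odd-pair x y r x·y)) (trans (sym (op-↭ L↭)) op≡)
      bound = subst (_≤ 1) (sym (suc-injective op≡′)) (≤-pred op≤2)
      ys , tri , len = odd-pair⇒triangular x y r x·y x≢y ux uy ur bound
  in ys , tri , subst (_≤ length ys) (sym (↭-length L↭)) len

oddSized⇒unit : {A : Subset n} → T (OddSized A) → Unit A
oddSized⇒unit {A = A} odd = begin
  A · A               ≡⟨ sym (isOdd-∣∩∣ A A) ⟩
  isOdd ∣ A ∩ A ∣     ≡⟨ cong (isOdd ∘ ∣_∣) (∩-idem A) ⟩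
  isOdd ∣ A ∣         ≡⟨ Equivalence.to T-≡ odd ⟩
  true                ∎

theorem2 : (n : ℕ) → 1 ≤ n → (𝒜 : List (Subset n)) → Unique 𝒜 →
           All (λ A → T (OddSized A)) 𝒜 → suc n ≤ length 𝒜 → 3 ≤ op 𝒜
theorem2 n _ 𝒜 unique odd n<|𝒜| with op 𝒜 ≤? 2
... | no op≰2 = ≰⇒> op≰2
... | yes op≤2 =
  let units = All.map (λ {A} → oddSized⇒unit {A = A}) odd
      ys , tri , |𝒜|≤|ys| = op≤2⇒triangular 𝒜 unique units op≤2
  in contradiction (≤-trans |𝒜|≤|ys| (triangular⇒length≤ tri)) (<⇒≱ n<|𝒜|)
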